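{- Let $G=(V,E)$ be a connected Eulerian digraph, $A$ an acyclic arc set of $G$ and $s$ a vertex of $G$. Then the cut-stretch $\Phi(A,s)$ of $A$ at $s$ is an acyclic arc set of $G$, and $|A|\le|\Phi(A,s)|$.
   Context: Digraphs are finite and simple; Eulerian means in-degree equals out-degree at every vertex. For $A\subseteq E$, $G[A]$ is the digraph $(V,A)$; $A$ is an acyclic arc set if $G[A]$ has no directed cycle. For $X\subseteq V$ let $\delta^+(X)=\{(u,v)\in E:u\in X, v\notin X\}$ and $\delta^-(X)=\{(u,v)\in E:u\notin X, v\in X\}$. For an acyclic arc set $A$ and vertex $s$, let $R$ be the set of vertices reachable from $s$ by a directed path in $G[A]$ (including $s$). The cut-stretch of $A$ at $s$ is $\Phi(A,s)=(A\setminus\delta^-(R))\cup\delta^+(R)$. -}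

module Defs where

open import Data.Nat using (ℕ; zero; suc; _+_)
open import Data.Fin using (Fin; zero; suc)
open import Data.Bool using (Bool; true; false; _∧_; _∨_; not; T)
open import Data.Product using (_×_)
open import Relation.Nullary using (¬_)
open import Relation.Binary.PropositionalEquality using (_≡_)
open import Relation.Binary.Construct.Closure.ReflexiveTransitive using (Star)
open import Relation.Binary.Construct.Closure.Transitive using (TransClosure)
open import Relation.Binary.Construct.Closure.Symmetric using (SymClosure)

-- A (simple) digraph on vertex set Fin n is given by its arc relation,
-- a Boolean adjacency matrix E with no loops. Parallel arcs cannot occur.
-- Arc sets are Boolean matrices of the same shape.
ArcSet : ℕ → Set
ArcSet n = Fin n → Fin n → Bool

Arc : ∀ {n} → ArcSet n → Fin n → Fin n → Set
Arc A u v = T (A u v)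

Loopless : ∀ {n} → ArcSet n → Set
Loopless {n} E = (v : Fin n) → E v v ≡ false

countB : ∀ {n} → (Fin n → Bool) → ℕ
countB {zero} f = 0
countB {suc n} f = (if f zero then 1 else 0) + countB (λ i → f (suc i))
  where
  if_then_else_ : Bool → ℕ → ℕ → ℕ
  if true then a else b = a
  if false then a else b = b

sumRows : ∀ {m n} → (Fin m → Fin n → Bool) → ℕ
sumRows {zero} A = 0
sumRows {suc m} A = countB (A zero) + sumRows (λ u v → A (suc u) v)

card : ∀ {n} → ArcSet n → ℕ
card A = sumRows A

outdeg indeg : ∀ {n} → ArcSet n → Fin n → ℕ
outdeg E v = countB (λ u → E v u)
indeg E v = countB (λ u → E u v)

Eulerian : ∀ {n} → ArcSet n → Set
Eulerian {n} E = (v : Fin n) → indeg E v ≡ outdeg E v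

Connected : ∀ {n} → ArcSet n → Set
Connected {n} E = (u v : Fin n) → Star (SymClosure (Arc E)) u v

_⊆ₐ_ : ∀ {n} → ArcSet n → ArcSet n → Set
_⊆ₐ_ {n} A B = (u v : Fin n) → T (A u v) → T (B u v)

Acyclic : ∀ {n} → ArcSet n → Set
Acyclic {n} A = (v : Fin n) → ¬ TransClosure (Arc A) v v

AcyclicArcSet : ∀ {n} → ArcSet n → ArcSet n → Set
AcyclicArcSet E A = (A ⊆ₐ E) × Acyclic A

Reachable : ∀ {n} → ArcSet n → Fin n → Fin n → Set
Reachable A s v = Star (Arc A) s v

-- cut-stretch, given the (Boolean) indicator r of the reachable set R:
--   Φ = (A \ δ⁻(R)) ∪ δ⁺(R),  δ⁻(R) = arcs of E entering R, δ⁺(R) = arcs of E leaving R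
cutStretch : ∀ {n} → ArcSet n → (Fin n → Bool) → ArcSet n → ArcSet n
cutStretch E r A u v =
  (A u v ∧ not (E u v ∧ not (r u) ∧ r v)) ∨ (E u v ∧ r u ∧ not (r v))

module Submission where

-- Let R be the set of vertices reachable from s in G[A] (given by its
-- indicator r), δ⁻(R) the arcs of E entering R and δ⁺(R) those leaving R,
-- so that Φ = (A ∖ δ⁻(R)) ∪ δ⁺(R).
--
-- * Φ ⊆ E, since A ⊆ E and δ⁺(R) ⊆ E.
-- * For any vertex set R, every Φ-arc with head in R is an A-arc with tail in
--   R, and every Φ-arc with tail outside R is an A-arc with head outside R. A
--   directed Φ-cycle therefore lies entirely inside R or entirely outside R
--   and is an A-cycle; so Φ is acyclic because A is.
-- * Counting: R is closed under A-arcs, so arc by arc, [a ∈ A] + [a ∈ δ⁺(R)] ≤ [a ∈ Φ] + [a ∈ δ⁻(R)], so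
--   |A| + |δ⁺(R)| ≤ |Φ| + |δ⁻(R)|. In an Eulerian digraph every vertex set has
--   |δ⁻(R)| = |δ⁺(R)| (both equal Σ_{v∈R} deg v minus the arcs inside R),
--   which gives |A| ≤ |Φ|.

open import Defs
open import Data.Nat using (ℕ; _≤_; _+_; _*_)
open import Data.Nat.Properties
  using (+-*-semiring; ≤-refl; +-mono-≤; m≤m+n; +-identityʳ; +-cancelʳ-≡; +-cancelʳ-≤)
open import Data.Fin using (Fin; zero; suc)
open import Data.Bool using (Bool; true; false; _∧_; _∨_; not; T)
open import Data.Bool.Properties using (T-∧; T-∨)
open import Data.Product using (_×_; _,_; proj₁)
open import Data.Sum using (inj₁; inj₂)
open import Data.Unit using (tt)
open import Data.Empty using (⊥-elim)
open import Function.Bundles using (_⇔_; Equivalence)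
open import Relation.Binary.PropositionalEquality
  using (_≡_; refl; sym; trans; cong; cong₂; subst; subst₂; module ≡-Reasoning)
open import Relation.Binary.Construct.Closure.ReflexiveTransitive using (ε; _◅_; _◅◅_)
open import Relation.Binary.Construct.Closure.Transitive using (TransClosure; [_]; _∷_)
open import Algebra.Properties.Semiring.Sum +-*-semiring
  using (sum; sum-syntax; sum-cong-≗; ∑-comm; ∑-distrib-+; *-distribʳ-sum)

𝟙 : Bool → ℕ
𝟙 true = 1
𝟙 false = 0

𝟙-∧ : ∀ x y → 𝟙 (x ∧ y) ≡ 𝟙 x * 𝟙 y
𝟙-∧ true y = sym (+-identityʳ (𝟙 y))
𝟙-∧ false y = refl

sum-mono : ∀ {n} {f g : Fin n → ℕ} → (∀ i → f i ≤ g i) → sum f ≤ sum g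
sum-mono {ℕ.zero} f≤g = ≤-refl
sum-mono {ℕ.suc n} f≤g = +-mono-≤ (f≤g zero) (sum-mono (λ i → f≤g (suc i)))

countB-∑ : ∀ {n} (f : Fin n → Bool) → countB f ≡ ∑[ i < n ] 𝟙 (f i)
countB-∑ {ℕ.zero} f = refl
countB-∑ {ℕ.suc n} f with f zero
... | true = cong ℕ.suc (countB-∑ (λ i → f (suc i)))
... | false = countB-∑ (λ i → f (suc i))

countB-∧ : ∀ {n} (f : Fin n → Bool) b → countB (λ i → f i ∧ b) ≡ countB f * 𝟙 b
countB-∧ {n} f b = begin
  countB (λ i → f i ∧ b)      ≡⟨ countB-∑ (λ i → f i ∧ b) ⟩
  ∑[ i < n ] 𝟙 (f i ∧ b)      ≡⟨ sum-cong-≗ (λ i → 𝟙-∧ (f i) b) ⟩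
  ∑[ i < n ] (𝟙 (f i) * 𝟙 b)  ≡⟨ sym (*-distribʳ-sum (𝟙 b) (λ i → 𝟙 (f i))) ⟩
  (∑[ i < n ] 𝟙 (f i)) * 𝟙 b  ≡⟨ cong (_* 𝟙 b) (sym (countB-∑ f)) ⟩
  countB f * 𝟙 b              ∎
  where open ≡-Reasoning

sumRows-∑ : ∀ {m n} (A : Fin m → Fin n → Bool) → sumRows A ≡ ∑[ u < m ] countB (A u)
sumRows-∑ {ℕ.zero} A = refl
sumRows-∑ {ℕ.suc m} A = cong (countB (A zero) +_) (sumRows-∑ (λ u → A (suc u)))

card-∑ : ∀ {n} (A : ArcSet n) → card A ≡ ∑[ u < n ] ∑[ v < n ] 𝟙 (A u v)
card-∑ A = trans (sumRows-∑ A) (sum-cong-≗ (λ u → countB-∑ (A u)))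

card-+ : ∀ {n} (A B : ArcSet n) →
         ∑[ u < n ] ∑[ v < n ] (𝟙 (A u v) + 𝟙 (B u v)) ≡ card A + card B
card-+ {n} A B = begin
  ∑[ u < n ] ∑[ v < n ] (𝟙 (A u v) + 𝟙 (B u v))
    ≡⟨ sum-cong-≗ (λ u → ∑-distrib-+ (λ v → 𝟙 (A u v)) (λ v → 𝟙 (B u v))) ⟩
  ∑[ u < n ] (∑[ v < n ] 𝟙 (A u v) + ∑[ v < n ] 𝟙 (B u v))
    ≡⟨ ∑-distrib-+ (λ u → ∑[ v < n ] 𝟙 (A u v)) (λ u → ∑[ v < n ] 𝟙 (B u v)) ⟩
  (∑[ u < n ] ∑[ v < n ] 𝟙 (A u v)) + (∑[ u < n ] ∑[ v < n ] 𝟙 (B u v))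
    ≡⟨ sym (cong₂ _+_ (card-∑ A) (card-∑ B)) ⟩
  card A + card B ∎
  where open ≡-Reasoning

card-split : ∀ {n} (A B C : ArcSet n) →
             (∀ u v → 𝟙 (A u v) ≡ 𝟙 (B u v) + 𝟙 (C u v)) → card A ≡ card B + card C
card-split A B C split =
  trans (card-∑ A) (trans (sum-cong-≗ (λ u → sum-cong-≗ (split u))) (card-+ B C))

card-exchange : ∀ {n} (A B C D : ArcSet n) →
                (∀ u v → 𝟙 (A u v) + 𝟙 (B u v) ≤ 𝟙 (C u v) + 𝟙 (D u v)) →
                card A + card B ≤ card C + card D
card-exchange A B C D le =
  subst₂ _≤_ (card-+ A B) (card-+ C D) (sum-mono (λ u → sum-mono (le u)))

leaving entering inside : ∀ {n} → ArcSet n → (Fin n → Bool) → ArcSet n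
leaving E r u v = E u v ∧ r u ∧ not (r v)
entering E r u v = E u v ∧ not (r u) ∧ r v
inside E r u v = E u v ∧ r u ∧ r v

head-split : ∀ e a b → 𝟙 (e ∧ b) ≡ 𝟙 (e ∧ not a ∧ b) + 𝟙 (e ∧ a ∧ b)
head-split false a b = refl
head-split true true b = refl
head-split true false b = sym (+-identityʳ (𝟙 b))

tail-split : ∀ e a b → 𝟙 (e ∧ a) ≡ 𝟙 (e ∧ a ∧ not b) + 𝟙 (e ∧ a ∧ b)
tail-split false a b = refl
tail-split true false b = refl
tail-split true true true = refl
tail-split true true false = refl

-- In an Eulerian digraph the arcs with head in R and those with tail in R are
-- equally many: both numbers are the sum of the degrees of the vertices of R.
heads-tails : ∀ {n} (E : ArcSet n) → Eulerian E → (r : Fin n → Bool) →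
              card (λ u v → E u v ∧ r v) ≡ card (λ u v → E u v ∧ r u)
heads-tails {n} E eulerian r = begin
  card (λ u v → E u v ∧ r v)                  ≡⟨ card-∑ (λ u v → E u v ∧ r v) ⟩
  ∑[ u < n ] ∑[ v < n ] 𝟙 (E u v ∧ r v)       ≡⟨ ∑-comm (λ u v → 𝟙 (E u v ∧ r v)) ⟩
  ∑[ v < n ] ∑[ u < n ] 𝟙 (E u v ∧ r v)       ≡⟨ sum-cong-≗ (λ v → sym (countB-∑ (λ u → E u v ∧ r v))) ⟩
  ∑[ v < n ] countB (λ u → E u v ∧ r v)       ≡⟨ sum-cong-≗ (λ v → countB-∧ (λ u → E u v) (r v)) ⟩
  ∑[ v < n ] (indeg E v * 𝟙 (r v))            ≡⟨ sum-cong-≗ (λ v → cong (_* 𝟙 (r v)) (eulerian v)) ⟩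
  ∑[ v < n ] (outdeg E v * 𝟙 (r v))           ≡⟨ sum-cong-≗ (λ v → sym (countB-∧ (E v) (r v))) ⟩
  ∑[ v < n ] countB (λ u → E v u ∧ r v)       ≡⟨ sym (sumRows-∑ (λ u v → E u v ∧ r u)) ⟩
  card (λ u v → E u v ∧ r u)                  ∎
  where open ≡-Reasoning

cut-balance : ∀ {n} (E : ArcSet n) → Eulerian E → (r : Fin n → Bool) →
              card (entering E r) ≡ card (leaving E r)
cut-balance E eulerian r = +-cancelʳ-≡ (card (inside E r)) _ _ (begin
  card (entering E r) + card (inside E r)
    ≡⟨ sym (card-split _ (entering E r) (inside E r) (λ u v → head-split (E u v) (r u) (r v))) ⟩
  card (λ u v → E u v ∧ r v)
    ≡⟨ heads-tails E eulerian r ⟩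
  card (λ u v → E u v ∧ r u)
    ≡⟨ card-split _ (leaving E r) (inside E r) (λ u v → tail-split (E u v) (r u) (r v)) ⟩
  card (leaving E r) + card (inside E r) ∎)
  where open ≡-Reasoning

walk-backward : {V : Set} {P Q : V → V → Set} {S : V → Set} →
                (∀ {x y} → P x y → S y → Q x y × S x) →
                ∀ {x z} → TransClosure P x z → S z → TransClosure Q x z × S x
walk-backward step [ p ] Sz with step p Sz
... | q , Sx = [ q ] , Sx
walk-backward step (p ∷ w) Sz with walk-backward step w Sz
... | w′ , Sy with step p Sy
... | q , Sx = q ∷ w′ , Sx

walk-forward : {V : Set} {P Q : V → V → Set} {S : V → Set} →
               (∀ {x y} → P x y → S x → Q x y × S y) →
               ∀ {x z} → TransClosure P x z → S x → TransClosure Q x z × S z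
walk-forward step [ p ] Sx with step p Sx
... | q , Sz = [ q ] , Sz
walk-forward step (p ∷ w) Sx with step p Sx
... | q , Sy with walk-forward step w Sy
... | w′ , Sz = q ∷ w′ , Sz

stretch : Bool → Bool → Bool → Bool → Bool
stretch a e x y = (a ∧ not (e ∧ not x ∧ y)) ∨ (e ∧ x ∧ not y)

-- A stretched arc with head in R is an arc of A with tail in R
-- (arcs leaving R have their head outside, arcs entering R were removed).
stretch-into : ∀ a e x y → (T a → T e) → T (stretch a e x y) → y ≡ true → T a × x ≡ true
stretch-into true true true true _ _ refl = tt , refl
stretch-into true true false true _ () refl
stretch-into true false x y A⊆E _ _ = ⊥-elim (A⊆E tt)
stretch-into false false x true _ () refl
stretch-into false true true true _ () refl
stretch-into false true false true _ () refl

stretch-out-of : ∀ a e x y → (T a → T e) → T (stretch a e x y) → x ≡ false → T a × y ≡ false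
stretch-out-of true true false false _ _ refl = tt , refl
stretch-out-of true true false true _ () refl
stretch-out-of true false x y A⊆E _ _ = ⊥-elim (A⊆E tt)
stretch-out-of false false false y _ () refl
stretch-out-of false true false true _ () refl
stretch-out-of false true false false _ () refl

stretch-exchange : ∀ a e x y → (T a → T e) → (T a → x ≡ true → y ≡ true) →
                   𝟙 a + 𝟙 (e ∧ x ∧ not y) ≤ 𝟙 (stretch a e x y) + 𝟙 (e ∧ not x ∧ y)
stretch-exchange false e x y _ _ = m≤m+n (𝟙 (e ∧ x ∧ not y)) (𝟙 (e ∧ not x ∧ y))
stretch-exchange true false x y A⊆E _ = ⊥-elim (A⊆E tt)
stretch-exchange true true true true _ _ = ≤-refl
stretch-exchange true true true false _ closed with closed tt refl
... | ()
stretch-exchange true true false true _ _ = ≤-refl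
stretch-exchange true true false false _ _ = ≤-refl

cutStretch-⊆ : ∀ {n} (E A : ArcSet n) (r : Fin n → Bool) → A ⊆ₐ E → cutStretch E r A ⊆ₐ E
cutStretch-⊆ E A r A⊆E u v uv∈Φ with Equivalence.to T-∨ uv∈Φ
... | inj₁ uv∈A∖entering = A⊆E u v (proj₁ (Equivalence.to T-∧ uv∈A∖entering))
... | inj₂ uv-leaving = proj₁ (Equivalence.to T-∧ uv-leaving)

-- For any vertex set R, a directed cycle of the cut-stretch lies inside R or
-- outside R and consists of arcs of A; so stretching preserves acyclicity.
cutStretch-acyclic : ∀ {n} (E A : ArcSet n) (r : Fin n → Bool) →
                     A ⊆ₐ E → Acyclic A → Acyclic (cutStretch E r A)
cutStretch-acyclic E A r A⊆E acyclic v cycle with r v in rv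
... | true  = acyclic v (proj₁ (walk-backward into cycle rv))
  where
  into : ∀ {x y} → Arc (cutStretch E r A) x y → r y ≡ true → Arc A x y × r x ≡ true
  into {x} {y} = stretch-into (A x y) (E x y) (r x) (r y) (A⊆E x y)
... | false = acyclic v (proj₁ (walk-forward out-of cycle rv))
  where
  out-of : ∀ {x y} → Arc (cutStretch E r A) x y → r x ≡ false → Arc A x y × r y ≡ false
  out-of {x} {y} = stretch-out-of (A x y) (E x y) (r x) (r y) (A⊆E x y)

-- If no arc of A leaves R and E is Eulerian, stretching does not decrease the
-- number of arcs: |A| + |δ⁺(R)| ≤ |Φ| + |δ⁻(R)| and |δ⁻(R)| = |δ⁺(R)|.
cutStretch-card : ∀ {n} (E A : ArcSet n) (r : Fin n → Bool) → Eulerian E → A ⊆ₐ E →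
                  (∀ u v → Arc A u v → r u ≡ true → r v ≡ true) →
                  card A ≤ card (cutStretch E r A)
cutStretch-card E A r eulerian A⊆E closed = +-cancelʳ-≤ (card (leaving E r)) _ _
  (subst (λ m → card A + card (leaving E r) ≤ card (cutStretch E r A) + m)
    (cut-balance E eulerian r)
    (card-exchange A (leaving E r) (cutStretch E r A) (entering E r)
      (λ u v → stretch-exchange (A u v) (E u v) (r u) (r v) (A⊆E u v) (closed u v))))

reachable-closed : ∀ {n} (A : ArcSet n) (s : Fin n) (r : Fin n → Bool) →
                   ((v : Fin n) → (r v ≡ true) ⇔ Reachable A s v) →
                   ∀ u v → Arc A u v → r u ≡ true → r v ≡ true
reachable-closed A s r reach u v uv∈A ru =
  Equivalence.from (reach v) (Equivalence.to (reach u) ru ◅◅ (uv∈A ◅ ε))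

lemma2 : (n : ℕ) (E : ArcSet n) → Loopless E → Connected E → Eulerian E →
         (A : ArcSet n) → AcyclicArcSet E A → (s : Fin n) →
         (r : Fin n → Bool) → ((v : Fin n) → (r v ≡ true) ⇔ Reachable A s v) →
         AcyclicArcSet E (cutStretch E r A) × (card A ≤ card (cutStretch E r A))
lemma2 n E _ _ eulerian A (A⊆E , acyclic) s r reach =
  (cutStretch-⊆ E A r A⊆E , cutStretch-acyclic E A r A⊆E acyclic) ,
  cutStretch-card E A r eulerian A⊆E (reachable-closed A s r reach)
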